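{- Every implicational structure $\mathbf{B}$ has $(2,3)$-path duality.
   Context: A vocabulary $\tau$ is a finite set of relation symbols with arities; a $\tau$-structure has a universe and a relation of the right arity for each symbol; structures are finite. A homomorphism $\mathbf{A}\to\mathbf{B}$ is a map between universes preserving all relations. A binary relation $R\subseteq B^2$ over a finite set $B$ is implicational if it has one of the forms: (1) $C_1\times C_2$ for some $C_1,C_2\subseteq B$; (2) $\{(a,f(a)):a\in C_1\}$ for some $C_1\subseteq B$ and some one-to-one map $f:C_1\to B$; (3) $(\{b\}\times C_2)\cup(C_1\times\{c\})$ for some $C_1,C_2\subseteq B$, $b\in C_1$, $c\in C_2$. A structure $\mathbf{B}$ (over a vocabulary of binary symbols) is implicational if all its relations are implicational. A path-decomposition of $\mathbf{P}$ is a sequence $S_1,\dots,S_n$ of subsets of its universe such that every relation tuple of $\mathbf{P}$ has all entries in some $S_i$, and if $a\in S_i\cap S_l$, $i\leq l$, then $a\in S_m$ for all $i\leq m\leq l$; $\mathbf{P}$ has pathwidth at most $(j,k)$ if some path-decomposition has $|S_i\cap S_{i+1}|\leq j$ for $i<n$ and $|S_i|\leq k$ for all $i$. $\mathbf{B}$ has $(j,k)$-path duality if there is a set $\mathcal O$ of finite $\tau$-structures, each of pathwidth at most $(j,k)$, such that for every finite $\tau$-structure $\mathbf{A}$: $\mathbf{A}\to\mathbf{B}$ iff no $\mathbf{P}\in\mathcal O$ satisfies $\mathbf{P}\to\mathbf{A}$. -}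

module Defs where

open import Data.Nat using (ℕ; suc; _≤_)
open import Data.Bool using (Bool; true)
open import Data.Fin using (Fin; toℕ)
open import Data.Fin.Subset using (Subset; _∈_; _∩_; ∣_∣)
open import Data.Product using (Σ; _×_; ∃; ∃-syntax)
open import Data.Sum using (_⊎_)
open import Relation.Binary.PropositionalEquality using (_≡_)
open import Relation.Nullary using (¬_)
open import Function.Bundles using (_⇔_)

record Structure (m : ℕ) : Set where
  field
    size : ℕ
    rel  : Fin m → Fin size → Fin size → Bool

open Structure public

Holds : ∀ {m} (A : Structure m) → Fin m → Fin (size A) → Fin (size A) → Set
Holds A R a b = rel A R a b ≡ true

Hom : ∀ {m} → Structure m → Structure m → Set
Hom A B = Σ (Fin (size A) → Fin (size B)) λ f →
  ∀ R a b → Holds A R a b → Holds B R (f a) (f b)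

BinRel : ℕ → Set
BinRel n = Fin n → Fin n → Bool

data Implicational {n : ℕ} (Rl : BinRel n) : Set where
  product : (C₁ C₂ : Subset n) →
    (∀ x y → (Rl x y ≡ true) ⇔ (x ∈ C₁ × y ∈ C₂)) → Implicational Rl
  graph : (C₁ : Subset n) (f : Fin n → Fin n) →
    (∀ x y → x ∈ C₁ → y ∈ C₁ → f x ≡ f y → x ≡ y) →
    (∀ x y → (Rl x y ≡ true) ⇔ (x ∈ C₁ × y ≡ f x)) → Implicational Rl
  cross : (C₁ C₂ : Subset n) (b c : Fin n) → b ∈ C₁ → c ∈ C₂ →
    (∀ x y → (Rl x y ≡ true) ⇔ ((x ≡ b × y ∈ C₂) ⊎ (x ∈ C₁ × y ≡ c))) →
    Implicational Rl

ImplicationalStructure : ∀ {m} → Structure m → Set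
ImplicationalStructure B = ∀ R → Implicational (rel B R)

record PathDecomposition {m} (P : Structure m) (j w : ℕ) : Set where
  field
    len   : ℕ
    bag   : Fin len → Subset (size P)
    covers : ∀ R a b → Holds P R a b → ∃[ i ] (a ∈ bag i × b ∈ bag i)
    interval : ∀ (a : Fin (size P)) (i l k : Fin len) →
      toℕ i ≤ toℕ k → toℕ k ≤ toℕ l → a ∈ bag i → a ∈ bag l → a ∈ bag k
    adjacent : ∀ (i i' : Fin len) → toℕ i' ≡ suc (toℕ i) →
      ∣ bag i ∩ bag i' ∣ ≤ j
    bagSize : ∀ (i : Fin len) → ∣ bag i ∣ ≤ w

PathwidthAtMost : ∀ {m} → ℕ → ℕ → Structure m → Set
PathwidthAtMost j w P = PathDecomposition P j w

PathDuality : ∀ {m} → ℕ → ℕ → Structure m → Set₁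
PathDuality {m} j k B = Σ (Structure m → Set) λ O →
  (∀ P → O P → PathwidthAtMost j k P) ×
  (∀ A → Hom A B ⇔ (¬ (∃[ P ] (O P × Hom P A))))

module Submission where

open import Data.Nat using (ℕ; zero; suc; _≤_; _<_; z≤n; s≤s; _+_)
open import Data.Nat.Induction using (<-wellFounded)
open import Data.Nat.Properties
  using (≤-trans; ≤-reflexive; ≤-antisym; n≤1+n; +-suc; suc-injective; m≤n⇒m<n∨m≡n)
open import Data.Bool using (Bool; true; false; _∧_)
open import Data.Bool.Properties using (∧-conicalˡ; ∧-conicalʳ) renaming (_≟_ to _≟ᵇ_)
open import Data.Fin using (Fin; zero; suc; toℕ; _≟_)
open import Data.Fin.Properties using (toℕ-injective; any?; all?)
open import Data.Fin.Subset using (Subset; _∈_; _∩_; _∪_; ∣_∣; ⁅_⁆; _⊆_)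
open import Data.Fin.Subset.Properties
  using (x∈⁅x⁆; x∈⁅y⁆⇒x≡y; ∣⁅x⁆∣≡1; p⊆q⇒∣p∣≤∣q∣; p⊂q⇒∣p∣<∣q∣; x∈p∩q⁻; x∈p∪q⁻; x∈p∪q⁺)
open import Data.List using (List; []; _∷_; _++_; length; lookup; concat; tabulate)
open import Data.List.Properties using (++-assoc)
open import Data.Maybe using (Maybe; just; nothing; is-nothing)
open import Data.Maybe.Properties using (just-injective) renaming (≡-dec to ≡-decₘ)
open import Data.Vec using (_∷_)
import Data.Vec as Vec
open import Data.Vec.Properties using (lookup∘tabulate; lookup⇒[]=; []=⇒lookup)
open import Data.Product using (_×_; _,_; proj₁; proj₂; ∃; ∃-syntax)
import Data.Product as Product
open import Data.Sum using (_⊎_; inj₁; inj₂; [_,_]′)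
open import Data.Empty using (⊥; ⊥-elim)
open import Induction.WellFounded using (Acc; acc)
open import Relation.Nullary using (¬_; Dec; yes; no)
open import Relation.Nullary.Decidable using (_×-dec_; _⊎-dec_; _→-dec_; ¬?; map′; decidable-stable)
open import Relation.Binary.PropositionalEquality using (_≡_; _≢_; refl; sym; trans; cong; subst)
open import Function using (flip; _∘_; id)
open import Function.Bundles using (Equivalence; mk⇔)
open import Defs

-- Arc-consistency style propagation. Call a partial map g : A ⇀ B saturated if every assigned
-- value has a partner along every tuple of A, and g is closed under forcing: if g y = e and a
-- tuple of A joins y to z while e has a single partner e' in the matching relation of B, then
-- g z = e'. Implicational relations are 0/1/all: every nonempty row and column is a singleton
-- or the whole range. Hence a total saturated map is a homomorphism, and forcing from a fresh
-- literal x ↦ d never reaches a vertex assigned earlier, since such a step could be reversed.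
-- So propagating x ↦ d either yields a larger saturated map, or fails at an unsupported value
-- or at two conflicting forced values. The failure is witnessed by a sequence of vertices of A
-- admitting no labelling compatible with x ↦ d and along consecutive vertices. Adding x as a
-- hub adjacent to the whole sequence gives a structure with bags {x, vᵢ, vᵢ₊₁}, hence of
-- pathwidth (2,3); chaining the sequences for all d behind one hub gives a structure that maps
-- to A but not to B.

-- Zero/one/all relations

module _ {n : ℕ} where
  open Equivalence

  HasSucc : BinRel n → Fin n → Set
  HasSucc S a = ∃[ t ] S a t ≡ true

  OnlySucc : BinRel n → Fin n → Fin n → Set
  OnlySucc S a b = S a b ≡ true × (∀ t → S a t ≡ true → t ≡ b)

  onlySucc? : ∀ S a b → Dec (OnlySucc S a b)
  onlySucc? S a b = (S a b ≟ᵇ true) ×-dec all? λ t → (S a t ≟ᵇ true) →-dec (t ≟ b)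

  ZeroOneAll : BinRel n → Set
  ZeroOneAll S = ∀ a → HasSucc S a →
    ∃ (OnlySucc S a) ⊎ (∀ t → HasSucc (flip S) t → S a t ≡ true)

  implicational⇒zeroOneAll : ∀ {S} → Implicational S → ZeroOneAll S
  implicational⇒zeroOneAll (product C₁ C₂ S⇔) a (t , Sat) =
    inj₂ λ u (s , Ssu) → from (S⇔ a u) (proj₁ (to (S⇔ a t) Sat) , proj₂ (to (S⇔ s u) Ssu))
  implicational⇒zeroOneAll (graph C₁ f _ S⇔) a (t , Sat) =
    inj₁ (f a , from (S⇔ a (f a)) (proj₁ (to (S⇔ a t) Sat) , refl) ,
          λ u Sau → proj₂ (to (S⇔ a u) Sau))
  implicational⇒zeroOneAll (cross C₁ C₂ b c _ c∈C₂ S⇔) a (t , Sat) with a ≟ b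
  ... | yes refl = inj₂ λ u (s , Ssu) → from (S⇔ a u) (inj₁ (refl , inC₂ (to (S⇔ s u) Ssu)))
    where
    inC₂ : ∀ {s u} → (s ≡ a × u ∈ C₂) ⊎ (s ∈ C₁ × u ≡ c) → u ∈ C₂
    inC₂ (inj₁ (_ , u∈C₂)) = u∈C₂
    inC₂ (inj₂ (_ , refl)) = c∈C₂
  ... | no a≢b = inj₁ (c , from (S⇔ a c) (inj₂ (inC₁ (to (S⇔ a t) Sat) , refl)) ,
                       λ u Sau → isC (to (S⇔ a u) Sau))
    where
    inC₁ : ∀ {u} → (a ≡ b × u ∈ C₂) ⊎ (a ∈ C₁ × u ≡ c) → a ∈ C₁
    inC₁ (inj₁ (a≡b , _))  = ⊥-elim (a≢b a≡b)
    inC₁ (inj₂ (a∈C₁ , _)) = a∈C₁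
    isC : ∀ {u} → (a ≡ b × u ∈ C₂) ⊎ (a ∈ C₁ × u ≡ c) → u ≡ c
    isC (inj₁ (a≡b , _)) = ⊥-elim (a≢b a≡b)
    isC (inj₂ (_ , u≡c)) = u≡c

  implicational⇒zeroOneAll-flip : ∀ {S} → Implicational S → ZeroOneAll (flip S)
  implicational⇒zeroOneAll-flip (product C₁ C₂ S⇔) a (t , Sta) =
    inj₂ λ u (s , Sus) → from (S⇔ u a) (proj₁ (to (S⇔ u s) Sus) , proj₂ (to (S⇔ t a) Sta))
  implicational⇒zeroOneAll-flip (graph C₁ f f-injective S⇔) a (t , Sta) =
    inj₁ (t , Sta , λ u Sua → f-injective u t (proj₁ (to (S⇔ u a) Sua)) (proj₁ (to (S⇔ t a) Sta))
                                (trans (sym (proj₂ (to (S⇔ u a) Sua))) (proj₂ (to (S⇔ t a) Sta))))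
  implicational⇒zeroOneAll-flip (cross C₁ C₂ b c _ c∈C₂ S⇔) a (t , Sta) with a ≟ c
  ... | yes refl = inj₂ λ u (s , Sus) → from (S⇔ u a) (toA (to (S⇔ u s) Sus))
    where
    toA : ∀ {u s} → (u ≡ b × s ∈ C₂) ⊎ (u ∈ C₁ × s ≡ a) → (u ≡ b × a ∈ C₂) ⊎ (u ∈ C₁ × a ≡ a)
    toA (inj₁ (u≡b , _))  = inj₁ (u≡b , c∈C₂)
    toA (inj₂ (u∈C₁ , _)) = inj₂ (u∈C₁ , refl)
  ... | no a≢c = inj₁ (b , from (S⇔ b a) (inj₁ (refl , inC₂ (to (S⇔ t a) Sta))) ,
                       λ u Sua → isB (to (S⇔ u a) Sua))
    where
    inC₂ : ∀ {u} → (u ≡ b × a ∈ C₂) ⊎ (u ∈ C₁ × a ≡ c) → a ∈ C₂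
    inC₂ (inj₁ (_ , a∈C₂)) = a∈C₂
    inC₂ (inj₂ (_ , a≡c))  = ⊥-elim (a≢c a≡c)
    isB : ∀ {u} → (u ≡ b × a ∈ C₂) ⊎ (u ∈ C₁ × a ≡ c) → u ≡ b
    isB (inj₁ (u≡b , _)) = u≡b
    isB (inj₂ (_ , a≡c)) = ⊥-elim (a≢c a≡c)

  onlyPred⇒onlySucc : ∀ {S e e' e''} → ZeroOneAll S → OnlySucc (flip S) e e' →
                      HasSucc S e'' → e'' ≢ e' → ∃ (OnlySucc S e'')
  onlyPred⇒onlySucc rows (Se'e , onlyPred) succ e''≢e' with rows _ succ
  ... | inj₁ singleton = singleton
  ... | inj₂ full      = ⊥-elim (e''≢e' (onlyPred _ (full _ (_ , Se'e))))

  zeroOneAll-edge : ∀ {S e e'} → ZeroOneAll S → HasSucc S e → HasSucc (flip S) e' →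
                    (∀ a → OnlySucc S e a → a ≡ e') → S e e' ≡ true
  zeroOneAll-edge {S} {e} rows succ pred forced with rows _ succ
  ... | inj₁ (a , only) = subst (λ t → S e t ≡ true) (forced a only) (proj₁ only)
  ... | inj₂ full       = full _ pred

-- Hub paths have pathwidth (2,3)

-- The first clause must stay first: it makes near (suc i) (suc j) reduce to near i j for
-- open i and j, which dropFirst relies on.
near : ℕ → ℕ → Bool
near (suc i)       (suc j)       = near i j
near zero          zero          = true
near zero          (suc zero)    = true
near zero          (suc (suc _)) = false
near (suc zero)    zero          = true
near (suc (suc _)) zero          = false

near-sound : ∀ i j → near i j ≡ true → j ≡ i ⊎ j ≡ suc i ⊎ i ≡ suc j
near-sound (suc i)    (suc j)    h with near-sound i j h
... | inj₁ j≡i          = inj₁ (cong suc j≡i)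
... | inj₂ (inj₁ j≡1+i) = inj₂ (inj₁ (cong suc j≡1+i))
... | inj₂ (inj₂ i≡1+j) = inj₂ (inj₂ (cong suc i≡1+j))
near-sound zero       zero       _ = inj₁ refl
near-sound zero       (suc zero) _ = inj₂ (inj₁ refl)
near-sound (suc zero) zero       _ = inj₂ (inj₂ refl)

hubPathEdge : ∀ {k} → Fin k → Fin k → Bool
hubPathEdge zero    _       = true
hubPathEdge (suc _) zero    = true
hubPathEdge (suc i) (suc j) = near (toℕ i) (toℕ j)

next : ∀ {K} → Fin (suc K) → Fin (suc K)
next {zero}  zero    = zero
next {suc K} zero    = suc zero
next {suc K} (suc i) = suc (next i)

next-bounds : ∀ {K} (i : Fin (suc K)) → toℕ i ≤ toℕ (next i) × toℕ (next i) ≤ suc (toℕ i)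
next-bounds {zero}  zero    = z≤n , z≤n
next-bounds {suc K} zero    = z≤n , s≤s z≤n
next-bounds {suc K} (suc i) = Product.map s≤s s≤s (next-bounds i)

next-suc : ∀ {K} (i j : Fin (suc K)) → toℕ j ≡ suc (toℕ i) → next i ≡ j
next-suc {suc K} zero    (suc zero) _ = refl
next-suc {suc K} (suc i) (suc j)    e = cong suc (next-suc i j (suc-injective e))

∣p∪q∣≤∣p∣+∣q∣ : ∀ {k} (p q : Subset k) → ∣ p ∪ q ∣ ≤ ∣ p ∣ + ∣ q ∣
∣p∪q∣≤∣p∣+∣q∣ Vec.[]      Vec.[]      = z≤n
∣p∪q∣≤∣p∣+∣q∣ (true ∷ p)  (true ∷ q)  =
  s≤s (≤-trans (∣p∪q∣≤∣p∣+∣q∣ p q) (≤-trans (n≤1+n _) (≤-reflexive (sym (+-suc ∣ p ∣ ∣ q ∣)))))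
∣p∪q∣≤∣p∣+∣q∣ (true ∷ p)  (false ∷ q) = s≤s (∣p∪q∣≤∣p∣+∣q∣ p q)
∣p∪q∣≤∣p∣+∣q∣ (false ∷ p) (true ∷ q)  =
  ≤-trans (s≤s (∣p∪q∣≤∣p∣+∣q∣ p q)) (≤-reflexive (sym (+-suc ∣ p ∣ ∣ q ∣)))
∣p∪q∣≤∣p∣+∣q∣ (false ∷ p) (false ∷ q) = ∣p∪q∣≤∣p∣+∣q∣ p q

∣⁅x⁆∪p∣≤1+∣p∣ : ∀ {k} (x : Fin k) (p : Subset k) → ∣ ⁅ x ⁆ ∪ p ∣ ≤ suc ∣ p ∣
∣⁅x⁆∪p∣≤1+∣p∣ x p = ≤-trans (∣p∪q∣≤∣p∣+∣q∣ ⁅ x ⁆ p) (≤-reflexive (cong (_+ ∣ p ∣) (∣⁅x⁆∣≡1 x)))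

bag : ∀ {K} → Fin (suc K) → Subset (suc K)
bag i = ⁅ zero ⁆ ∪ (⁅ i ⁆ ∪ ⁅ next i ⁆)

hub∈bag : ∀ {K} (i : Fin (suc K)) → zero ∈ bag i
hub∈bag i = x∈p∪q⁺ (inj₁ (x∈⁅x⁆ zero))

∈-bag⁺ : ∀ {K} (a i : Fin (suc K)) → toℕ a ≡ toℕ i ⊎ toℕ a ≡ suc (toℕ i) → a ∈ bag i
∈-bag⁺ a i (inj₁ a≡i) rewrite toℕ-injective a≡i =
  x∈p∪q⁺ (inj₂ (x∈p∪q⁺ (inj₁ (x∈⁅x⁆ i))))
∈-bag⁺ a i (inj₂ a≡1+i) rewrite sym (next-suc i a a≡1+i) =
  x∈p∪q⁺ (inj₂ (x∈p∪q⁺ (inj₂ (x∈⁅x⁆ (next i)))))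

∈-bag⁻ : ∀ {K} {a i : Fin (suc K)} → a ∈ bag i →
         a ≡ zero ⊎ (toℕ i ≤ toℕ a × toℕ a ≤ suc (toℕ i))
∈-bag⁻ {i = i} a∈ with x∈p∪q⁻ ⁅ zero ⁆ _ a∈
... | inj₁ a∈hub = inj₁ (x∈⁅y⁆⇒x≡y zero a∈hub)
... | inj₂ a∈path with x∈p∪q⁻ ⁅ i ⁆ _ a∈path
...   | inj₁ a∈⁅i⁆    rewrite x∈⁅y⁆⇒x≡y i a∈⁅i⁆ = inj₂ (≤-reflexive refl , n≤1+n _)
...   | inj₂ a∈⁅next⁆ rewrite x∈⁅y⁆⇒x≡y (next i) a∈⁅next⁆ = inj₂ (next-bounds i)

bag-interval : ∀ {K} (a i l k : Fin (suc K)) → toℕ i ≤ toℕ k → toℕ k ≤ toℕ l →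
               a ∈ bag i → a ∈ bag l → a ∈ bag k
bag-interval a i l k i≤k k≤l a∈i a∈l with ∈-bag⁻ a∈i | ∈-bag⁻ a∈l
... | inj₁ refl        | _              = hub∈bag k
... | inj₂ _           | inj₁ refl      = hub∈bag k
... | inj₂ (_ , a≤1+i) | inj₂ (l≤a , _) with m≤n⇒m<n∨m≡n (≤-trans a≤1+i (s≤s i≤k))
...   | inj₁ (s≤s a≤k) = ∈-bag⁺ a k (inj₁ (≤-antisym a≤k (≤-trans k≤l l≤a)))
...   | inj₂ a≡1+k     = ∈-bag⁺ a k (inj₂ a≡1+k)

bag-overlap : ∀ {K} (i i' : Fin (suc K)) → toℕ i' ≡ suc (toℕ i) → ∣ bag i ∩ bag i' ∣ ≤ 2
bag-overlap i i' i'≡1+i =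
  ≤-trans (p⊆q⇒∣p∣≤∣q∣ overlap⊆)
          (≤-trans (∣⁅x⁆∪p∣≤1+∣p∣ zero ⁅ i' ⁆) (s≤s (≤-reflexive (∣⁅x⁆∣≡1 i'))))
  where
  overlap⊆ : bag i ∩ bag i' ⊆ ⁅ zero ⁆ ∪ ⁅ i' ⁆
  overlap⊆ y∈ with x∈p∩q⁻ (bag i) (bag i') y∈
  ... | y∈i , y∈i' with ∈-bag⁻ y∈i | ∈-bag⁻ y∈i'
  ...   | inj₁ refl        | _               = x∈p∪q⁺ (inj₁ (x∈⁅x⁆ zero))
  ...   | inj₂ _           | inj₁ refl       = x∈p∪q⁺ (inj₁ (x∈⁅x⁆ zero))
  ...   | inj₂ (_ , y≤1+i) | inj₂ (i'≤y , _) =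
    x∈p∪q⁺ (inj₂ (subst (_∈ ⁅ i' ⁆) (toℕ-injective (≤-antisym i'≤y y≤i')) (x∈⁅x⁆ i')))
    where
    y≤i' = ≤-trans y≤1+i (≤-reflexive (sym i'≡1+i))

bag-size : ∀ {K} (i : Fin (suc K)) → ∣ bag i ∣ ≤ 3
bag-size i =
  ≤-trans (∣⁅x⁆∪p∣≤1+∣p∣ zero (⁅ i ⁆ ∪ ⁅ next i ⁆))
          (s≤s (≤-trans (∣⁅x⁆∪p∣≤1+∣p∣ i ⁅ next i ⁆) (s≤s (≤-reflexive (∣⁅x⁆∣≡1 (next i))))))

bag-covers : ∀ {K} (a b : Fin (suc K)) → hubPathEdge a b ≡ true → ∃[ i ] (a ∈ bag i × b ∈ bag i)
bag-covers zero    b       _ = b , hub∈bag b , ∈-bag⁺ b b (inj₁ refl)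
bag-covers (suc a) zero    _ = suc a , ∈-bag⁺ (suc a) (suc a) (inj₁ refl) , hub∈bag (suc a)
bag-covers (suc a) (suc b) near-ab with near-sound (toℕ a) (toℕ b) near-ab
... | inj₁ b≡a          =
  suc a , ∈-bag⁺ (suc a) (suc a) (inj₁ refl) , ∈-bag⁺ (suc b) (suc a) (inj₁ (cong suc b≡a))
... | inj₂ (inj₁ b≡1+a) =
  suc a , ∈-bag⁺ (suc a) (suc a) (inj₁ refl) , ∈-bag⁺ (suc b) (suc a) (inj₂ (cong suc b≡1+a))
... | inj₂ (inj₂ a≡1+b) =
  suc b , ∈-bag⁺ (suc a) (suc b) (inj₂ (cong suc a≡1+b)) , ∈-bag⁺ (suc b) (suc b) (inj₁ refl)

hubPathShaped-pathwidth : ∀ {m K} (r : Fin m → Fin (suc K) → Fin (suc K) → Bool) →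
                          (∀ R a b → r R a b ≡ true → hubPathEdge a b ≡ true) →
                          PathwidthAtMost 2 3 (record { size = suc K ; rel = r })
hubPathShaped-pathwidth {K = K} r shaped = record
  { len      = suc K
  ; bag      = bag
  ; covers   = λ R a b H → bag-covers a b (shaped R a b H)
  ; interval = bag-interval
  ; adjacent = bag-overlap
  ; bagSize  = bag-size
  }

-- An arc is a relation symbol read forwards or backwards, so that a constraint can be
-- propagated from either of its ends by the same argument.
data Direction : Set where
  forward backward : Direction

Arc : ℕ → Set
Arc m = Fin m × Direction

arcRel : ∀ {m} (S : Structure m) → Arc m → BinRel (size S)
arcRel S (R , forward)  = rel S R
arcRel S (R , backward) = flip (rel S R)

anyArc? : ∀ {m} {P : Arc m → Set} → (∀ α → Dec (P α)) → Dec (∃ P)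
anyArc? P? = map′ (λ { (R , inj₁ p) → (R , forward) , p ; (R , inj₂ p) → (R , backward) , p })
                  (λ { ((R , forward) , p) → R , inj₁ p ; ((R , backward) , p) → R , inj₂ p })
                  (any? λ R → P? (R , forward) ⊎-dec P? (R , backward))

arc-zeroOneAll : ∀ {m} {B : Structure m} → ImplicationalStructure B → ∀ α → ZeroOneAll (arcRel B α)
arc-zeroOneAll impl (R , forward)  = implicational⇒zeroOneAll (impl R)
arc-zeroOneAll impl (R , backward) = implicational⇒zeroOneAll-flip (impl R)

-- Homomorphism or obstruction

∧-true : ∀ {a b} → a ≡ true → b ≡ true → a ∧ b ≡ true
∧-true refl b≡true = b≡true

first-or-all : ∀ {k} {P Q : Fin k → Set} → (∀ i → P i ⊎ Q i) → ∃ P ⊎ (∀ i → Q i)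
first-or-all {zero}  _ = inj₂ λ ()
first-or-all {suc k} p⊎q with p⊎q zero | first-or-all (p⊎q ∘ suc)
... | inj₁ p | _            = inj₁ (zero , p)
... | inj₂ _ | inj₁ (i , p) = inj₁ (suc i , p)
... | inj₂ q | inj₂ qs      = inj₂ λ { zero → q ; (suc i) → qs i }

hom-trans : ∀ {m} {P Q S : Structure m} → Hom P Q → Hom Q S → Hom P S
hom-trans (f , f-hom) (g , g-hom) = g ∘ f , λ R a b H → g-hom R _ _ (f-hom R a b H)

Obstruction : ∀ {m} → Structure m → Structure m → Set
Obstruction B P = PathwidthAtMost 2 3 P × ¬ Hom P B

module HomOrObstruction {m : ℕ} (A B : Structure m) (impl : ImplicationalStructure B) where

  V : Set
  V = Fin (size A)

  D : Set
  D = Fin (size B)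

  Lit : Set
  Lit = V × D

  Compatible : Lit → Lit → Set
  Compatible (a , v) (b , w) = ∀ α → arcRel A α a b ≡ true → arcRel B α v w ≡ true

  Forces : Lit → Lit → Set
  Forces (y , e) (z , e') = ∃[ α ] (arcRel A α y z ≡ true × OnlySucc (arcRel B α) e e')

  Unsupported : Lit → Set
  Unsupported (y , e) = ∃[ α ] ∃[ z ] (arcRel A α y z ≡ true × ¬ HasSucc (arcRel B α) e)

  forces? : ∀ p q → Dec (Forces p q)
  forces? (y , e) (z , e') =
    anyArc? λ α → (arcRel A α y z ≟ᵇ true) ×-dec onlySucc? (arcRel B α) e e'

  unsupported? : ∀ p → Dec (Unsupported p)
  unsupported? (y , e) = anyArc? λ α → any? λ z →
    (arcRel A α y z ≟ᵇ true) ×-dec ¬? (any? λ t → arcRel B α e t ≟ᵇ true)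

  compatible-sym : ∀ {p q} → Compatible p q → Compatible q p
  compatible-sym c (R , forward)  = c (R , backward)
  compatible-sym c (R , backward) = c (R , forward)

  forced-value : ∀ {p z e' w} → Forces p (z , e') → Compatible p (z , w) → w ≡ e'
  forced-value (α , H , _ , only) c = only _ (c α H)

  supported⇒hasSucc : ∀ {y e} → ¬ Unsupported (y , e) →
                      ∀ α {z} → arcRel A α y z ≡ true → HasSucc (arcRel B α) e
  supported⇒hasSucc {e = e} supported α {z} H =
    decidable-stable (any? λ t → arcRel B α e t ≟ᵇ true) λ none → supported (α , z , H , none)

  forces-back : ∀ {y e z e' e''} → Forces (y , e) (z , e') → ¬ Unsupported (z , e'') → e'' ≢ e' →
                ∃[ a ] Forces (z , e'') (y , a)
  forces-back {y} {e} {z} {e'} {e''} f supported e''≢e' = reverse f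
    where
    along : ∀ β → arcRel A β z y ≡ true → OnlySucc (flip (arcRel B β)) e e' →
            ∃[ a ] Forces (z , e'') (y , a)
    along β H only = Product.map₂ (λ only′ → β , H , only′)
      (onlyPred⇒onlySucc (arc-zeroOneAll impl β) only (supported⇒hasSucc supported β H) e''≢e')
    reverse : Forces (y , e) (z , e') → ∃[ a ] Forces (z , e'') (y , a)
    reverse ((R , forward)  , H , only) = along (R , backward) H only
    reverse ((R , backward) , H , only) = along (R , forward) H only

  -- What a homomorphism HubPath x ℓ → B induces on ℓ, h being the image of the hub (hom⇒walk).
  data Walk (h : Lit) : Lit → List V → Set where
    stop : ∀ {p} → Compatible h p → Walk h p []
    move : ∀ {p a w ℓ} → Compatible h p → Compatible p (a , w) → Walk h (a , w) ℓ →
           Walk h p (a ∷ ℓ)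

  Refutes : Lit → List V → Set
  Refutes h ℓ = ¬ Walk h h ℓ

  walk-hub : ∀ {h p ℓ} → Walk h p ℓ → Compatible h p
  walk-hub (stop c)     = c
  walk-hub (move c _ _) = c

  walk-++⁻ˡ : ∀ {h p} ℓ₁ {ℓ₂} → Walk h p (ℓ₁ ++ ℓ₂) → Walk h p ℓ₁
  walk-++⁻ˡ []       W             = stop (walk-hub W)
  walk-++⁻ˡ (_ ∷ ℓ₁) (move c c' W) = move c c' (walk-++⁻ˡ ℓ₁ W)

  walk-++⁻ʳ : ∀ {h} ℓ₁ {ℓ₂} → Walk h h (ℓ₁ ++ ℓ₂) → Walk h h ℓ₂
  walk-++⁻ʳ {h} ℓ₁ W = restart (proj₂ (drop ℓ₁ W))
    where
    drop : ∀ {p} ℓ₁ {ℓ₂} → Walk h p (ℓ₁ ++ ℓ₂) → ∃[ q ] Walk h q ℓ₂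
    drop []       W'            = _ , W'
    drop (_ ∷ ℓ₁) (move _ _ W') = drop ℓ₁ W'
    restart : ∀ {q ℓ} → Walk h q ℓ → Walk h h ℓ
    restart (stop _)      = stop (walk-hub W)
    restart (move _ _ W') = move (walk-hub W) (walk-hub W') W'

  walk-concat⁻ : ∀ {h k} (f : Fin k → List V) i → Walk h h (concat (tabulate f)) → Walk h h (f i)
  walk-concat⁻ f zero    W = walk-++⁻ˡ (f zero) W
  walk-concat⁻ f (suc i) W = walk-concat⁻ (f ∘ suc) i (walk-++⁻ʳ (f zero) W)

  infixl 5 _▷_

  data Path (s : Lit) : Lit → Set where
    here : Path s s
    _▷_  : ∀ {q r} → Path s q → Forces q r → Path s r

  vertices : ∀ {s t} → Path s t → List V
  vertices here              = []
  vertices (_▷_ {r = r} π _) = vertices π ++ proj₁ r ∷ []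

  verticesBackwards : ∀ {s t} → Path s t → List V
  verticesBackwards here              = []
  verticesBackwards (_▷_ {r = r} π _) = proj₁ r ∷ verticesBackwards π

  walk-along : ∀ {h t} (π : Path h t) ℓ → Walk h h (vertices π ++ ℓ) → Walk h t ℓ
  walk-along here ℓ W = W
  walk-along {h} (_▷_ {r = z , e'} π f) ℓ W
    with walk-along π (z ∷ ℓ) (subst (Walk h h) (++-assoc (vertices π) (z ∷ []) ℓ) W)
  ... | move _ c W' = subst (λ w → Walk h (z , w) ℓ) (forced-value f c) W'

  Excludes : Lit → Lit → Set
  Excludes p t = ∀ {w} → Compatible p (proj₁ t , w) → w ≢ proj₂ t

  walk-against : ∀ {h t p} (π : Path h t) → Walk h p (verticesBackwards π) → Excludes p t → ⊥
  walk-against here    W            excluded = excluded (compatible-sym (walk-hub W)) refl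
  walk-against (π ▷ f) (move _ c W) excluded =
    walk-against π W λ { c' refl → excluded c (forced-value f (compatible-sym c')) }

  refute-unsupported : ∀ {h y e} (π : Path h (y , e)) α z → arcRel A α y z ≡ true →
                       ¬ HasSucc (arcRel B α) e → Refutes h (vertices π ++ z ∷ [])
  refute-unsupported π α z H none W with walk-along π _ W
  ... | move _ c _ = none (_ , c α H)

  refute-conflict : ∀ {h y e z e' e''} (π₁ : Path h (y , e)) → Forces (y , e) (z , e') →
                    (π₂ : Path h (z , e'')) → e' ≢ e'' →
                    Refutes h (vertices π₁ ++ verticesBackwards π₂)
  refute-conflict π₁ f π₂ e'≢e'' W =
    walk-against π₂ (walk-along π₁ _ W) λ c w≡e'' → e'≢e'' (trans (sym (forced-value f c)) w≡e'')

  HubPath : V → List V → Structure m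
  HubPath x ℓ = record
    { size = suc (length ℓ)
    ; rel  = λ R i j → hubPathEdge i j ∧ rel A R (lookup (x ∷ ℓ) i) (lookup (x ∷ ℓ) j)
    }

  hubPath-pathwidth : ∀ x ℓ → PathwidthAtMost 2 3 (HubPath x ℓ)
  hubPath-pathwidth x ℓ = hubPathShaped-pathwidth _ λ R i j → ∧-conicalˡ _ _

  hubPath→A : ∀ x ℓ → Hom (HubPath x ℓ) A
  hubPath→A x ℓ = lookup (x ∷ ℓ) , λ R i j → ∧-conicalʳ _ _

  dropFirst : ∀ {x a ℓ} → Hom (HubPath x (a ∷ ℓ)) B → Hom (HubPath x ℓ) B
  dropFirst {x} {a} {ℓ} (h , hom) = h ∘ skip , λ R i j H → hom R (skip i) (skip j) (preserves R i j H)
    where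
    skip : Fin (suc (length ℓ)) → Fin (suc (suc (length ℓ)))
    skip zero    = zero
    skip (suc i) = suc (suc i)
    preserves : ∀ R i j → Holds (HubPath x ℓ) R i j → Holds (HubPath x (a ∷ ℓ)) R (skip i) (skip j)
    preserves R zero    zero    H = H
    preserves R zero    (suc j) H = H
    preserves R (suc i) zero    H = H
    preserves R (suc i) (suc j) H = H

  hom⇒compatible : ∀ {x ℓ} (h : Hom (HubPath x ℓ) B) i j →
                   hubPathEdge i j ≡ true → hubPathEdge j i ≡ true →
                   Compatible (lookup (x ∷ ℓ) i , proj₁ h i) (lookup (x ∷ ℓ) j , proj₁ h j)
  hom⇒compatible (_ , hom) i j ij _  (R , forward)  H = hom R i j (∧-true ij H)
  hom⇒compatible (_ , hom) i j _  ji (R , backward) H = hom R j i (∧-true ji H)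

  hom⇒walk-from-first : ∀ {x a ℓ} (h : Hom (HubPath x (a ∷ ℓ)) B) →
                        Walk (x , proj₁ h zero) (a , proj₁ h (suc zero)) ℓ
  hom⇒walk-from-first {ℓ = []}    h = stop (hom⇒compatible h zero (suc zero) refl refl)
  hom⇒walk-from-first {ℓ = _ ∷ _} h =
    move (hom⇒compatible h zero (suc zero) refl refl)
         (hom⇒compatible h (suc zero) (suc (suc zero)) refl refl)
         (hom⇒walk-from-first (dropFirst h))

  hom⇒walk : ∀ {x ℓ} (h : Hom (HubPath x ℓ) B) → Walk (x , proj₁ h zero) (x , proj₁ h zero) ℓ
  hom⇒walk {ℓ = []}    h = stop (hom⇒compatible h zero zero refl refl)
  hom⇒walk {ℓ = _ ∷ _} h =
    move (hom⇒compatible h zero zero refl refl) (hom⇒compatible h zero (suc zero) refl refl)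
         (hom⇒walk-from-first h)

  -- The hub lies in every bag, so a single hub path can carry the refutations of all the
  -- values of x one after another.
  hubPath-obstruction : ∀ x → (∀ d → ∃ (Refutes (x , d))) → ∃[ P ] (Obstruction B P × Hom P A)
  hubPath-obstruction x refutations = HubPath x ℓ , (hubPath-pathwidth x ℓ , no-hom) , hubPath→A x ℓ
    where
    ℓ : List V
    ℓ = concat (tabulate (proj₁ ∘ refutations))
    no-hom : ¬ Hom (HubPath x ℓ) B
    no-hom h = proj₂ (refutations (proj₁ h zero))
                     (walk-concat⁻ (proj₁ ∘ refutations) (proj₁ h zero) (hom⇒walk h))

  Assignment : Set
  Assignment = V → Maybe D

  infix 4 _⊑_

  _⊑_ : Assignment → Assignment → Set
  g ⊑ g' = ∀ {y e} → g y ≡ just e → g' y ≡ just e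

  ⊑-unassigned : ∀ {g g' y} → g ⊑ g' → g' y ≡ nothing → g y ≡ nothing
  ⊑-unassigned {g} {y = y} g⊑g' g'y with g y in gy
  ... | nothing = refl
  ... | just _  with trans (sym (g⊑g' gy)) g'y
  ...   | ()

  _[_≔_] : Assignment → V → D → Assignment
  (g [ z ≔ v ]) y with y ≟ z
  ... | yes _ = just v
  ... | no  _ = g y

  update-here : ∀ g z v → (g [ z ≔ v ]) z ≡ just v
  update-here g z v with z ≟ z
  ... | yes _   = refl
  ... | no  z≢z = ⊥-elim (z≢z refl)

  update-extends : ∀ g z v → g z ≡ nothing → g ⊑ g [ z ≔ v ]
  update-extends g z v gz {y} gy with y ≟ z
  ... | yes refl with trans (sym gy) gz
  ...   | ()
  update-extends g z v gz gy | no _ = gy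

  update-just : ∀ g z v {y u} → (g [ z ≔ v ]) y ≡ just u → (y ≡ z × u ≡ v) ⊎ g y ≡ just u
  update-just g z v {y} g'y with y ≟ z
  ... | yes y≡z = inj₁ (y≡z , sym (just-injective g'y))
  ... | no  _   = inj₂ g'y

  Unassigned : Assignment → Subset (size A)
  Unassigned g = Vec.tabulate (is-nothing ∘ g)

  ∈-unassigned⁺ : ∀ {g y} → g y ≡ nothing → y ∈ Unassigned g
  ∈-unassigned⁺ {g} {y} gy =
    lookup⇒[]= y _ (trans (lookup∘tabulate (is-nothing ∘ g) y) (cong is-nothing gy))

  ∈-unassigned⁻ : ∀ {g y} → y ∈ Unassigned g → g y ≡ nothing
  ∈-unassigned⁻ {g} {y} y∈ with g y | trans (sym (lookup∘tabulate (is-nothing ∘ g) y)) ([]=⇒lookup y∈)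
  ... | nothing | _  = refl
  ... | just _  | ()

  ⊑⇒unassigned-⊆ : ∀ {g g'} → g ⊑ g' → Unassigned g' ⊆ Unassigned g
  ⊑⇒unassigned-⊆ {g} {g'} g⊑g' {y} y∈ =
    ∈-unassigned⁺ {g} {y} (⊑-unassigned {g} {g'} g⊑g' (∈-unassigned⁻ {g'} y∈))

  extension-shrinks : ∀ {g g' z v} → g ⊑ g' → g z ≡ nothing → g' z ≡ just v →
                      ∣ Unassigned g' ∣ < ∣ Unassigned g ∣
  extension-shrinks {g} {g'} {z} g⊑g' gz g'z =
    p⊂q⇒∣p∣<∣q∣ (⊑⇒unassigned-⊆ g⊑g' , z , ∈-unassigned⁺ gz , z-assigned)
    where
    z-assigned : z ∈ Unassigned g' → ⊥
    z-assigned z∈ with trans (sym g'z) (∈-unassigned⁻ {g'} z∈)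
    ... | ()

  record Saturated (g : Assignment) : Set where
    field
      closed    : ∀ {y e z e'} → g y ≡ just e → Forces (y , e) (z , e') → g z ≡ just e'
      supported : ∀ {y e} → g y ≡ just e → ¬ Unsupported (y , e)

  empty : Assignment
  empty _ = nothing

  empty-saturated : Saturated empty
  empty-saturated = record { closed = λ () ; supported = λ () }

  saturated-total⇒hom : ∀ {g} → Saturated g → (∀ y → g y ≢ nothing) → Hom A B
  saturated-total⇒hom {g} sat total = h , preserves
    where
    open Saturated sat
    value : ∀ y → ∃[ e ] g y ≡ just e
    value y with g y in gy
    ... | just e  = e , refl
    ... | nothing = ⊥-elim (total y gy)
    h : V → D
    h = proj₁ ∘ value
    preserves : ∀ R a b → Holds A R a b → Holds B R (h a) (h b)
    preserves R a b H =
      zeroOneAll-edge (arc-zeroOneAll impl (R , forward))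
        (supported⇒hasSucc (supported ga) (R , forward) H)
        (supported⇒hasSucc (supported gb) (R , backward) H)
        λ e' only → just-injective (trans (sym (closed ga ((R , forward) , H , only))) gb)
      where
      ga = proj₂ (value a)
      gb = proj₂ (value b)

  _≟ₘ_ : (u v : Maybe D) → Dec (u ≡ v)
  _≟ₘ_ = ≡-decₘ _≟_

  module Propagation {g : Assignment} (sat : Saturated g) where
    open Saturated sat

    source-is-new : ∀ {g' y e z e'} → g ⊑ g' → g' y ≡ just e → Forces (y , e) (z , e') →
                    g' z ≢ just e' → g y ≡ nothing
    source-is-new {y = y} g⊑g' g'y f g'z≢e' with g y in gy
    ... | nothing = refl
    ... | just _ with just-injective (trans (sym (g⊑g' gy)) g'y)
    ...   | refl = ⊥-elim (g'z≢e' (g⊑g' (closed gy f)))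

    -- This is where B being implicational keeps propagation local: a step forced into an old
    -- vertex z could be reversed, and then the closure of g would already have assigned y.
    target-is-new : ∀ {g' y e z e' e''} → g ⊑ g' → g y ≡ nothing → Forces (y , e) (z , e') →
                    g' z ≡ just e'' → e'' ≢ e' → g z ≡ nothing
    target-is-new {z = z} g⊑g' gy f g'z e''≢e' with g z in gz
    ... | nothing = refl
    ... | just _ with just-injective (trans (sym (g⊑g' gz)) g'z)
    ...   | refl with trans (sym gy) (closed gz (proj₂ (forces-back f (supported gz) e''≢e')))
    ...     | ()

    supported-extension : ∀ {g'} → g ⊑ g' →
                          (∀ {y e} → g y ≡ nothing → g' y ≡ just e → ¬ Unsupported (y , e)) →
                          ∀ {y e} → g' y ≡ just e → ¬ Unsupported (y , e)
    supported-extension g⊑g' supported-new {y} g'y with g y in gy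
    ... | nothing = supported-new gy g'y
    ... | just _ with just-injective (trans (sym (g⊑g' gy)) g'y)
    ...   | refl = supported gy

    data Defect (g' : Assignment) : Set where
      unsupported : ∀ {y e} → g y ≡ nothing → g' y ≡ just e → Unsupported (y , e) → Defect g'
      unclosed    : ∀ {y e z e'} → g' y ≡ just e → Forces (y , e) (z , e') → g' z ≢ just e' →
                    Defect g'

    defect-or-saturated : ∀ {g'} → g ⊑ g' → Defect g' ⊎ Saturated g'
    defect-or-saturated {g'} g⊑g'
      with any? (λ y → any? λ e → (g y ≟ₘ nothing) ×-dec (g' y ≟ₘ just e) ×-dec unsupported? (y , e))
         | any? (λ y → any? λ e → any? λ z → any? λ e' →
                   (g' y ≟ₘ just e) ×-dec forces? (y , e) (z , e') ×-dec ¬? (g' z ≟ₘ just e'))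
    ... | yes (_ , _ , gy , g'y , u) | _ = inj₁ (unsupported gy g'y u)
    ... | no _ | yes (_ , _ , _ , _ , g'y , f , g'z≢e') = inj₁ (unclosed g'y f g'z≢e')
    ... | no no-unsupported | no no-unclosed = inj₂ record
      { closed    = λ g'y f → decidable-stable (_ ≟ₘ _) λ g'z≢e' →
                      no-unclosed (_ , _ , _ , _ , g'y , f , g'z≢e')
      ; supported = supported-extension g⊑g' λ gy g'y u → no-unsupported (_ , _ , gy , g'y , u)
      }

    Outcome : V → D → Set
    Outcome x d = (∃[ g' ] (Saturated g' × g ⊑ g' × g' x ≡ just d)) ⊎ ∃ (Refutes (x , d))

    module _ {x} (x-free : g x ≡ nothing) (d : D) where

      record Grown (g' : Assignment) : Set where
        field
          extends : g ⊑ g'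
          root    : g' x ≡ just d
          reached : ∀ {y e} → g y ≡ nothing → g' y ≡ just e → Path (x , d) (y , e)
      open Grown

      start : Grown (g [ x ≔ d ])
      start = record
        { extends = update-extends g x d x-free
        ; root    = update-here g x d
        ; reached = reached-root
        }
        where
        reached-root : ∀ {y e} → g y ≡ nothing → (g [ x ≔ d ]) y ≡ just e → Path (x , d) (y , e)
        reached-root {y} gy g'y with update-just g x d {y} g'y
        ... | inj₁ (refl , refl) = here
        ... | inj₂ gy≡e with trans (sym gy) gy≡e
        ...   | ()

      grow : ∀ {g' y e z e'} → Grown g' → g' y ≡ just e → g y ≡ nothing → Forces (y , e) (z , e') →
             g' z ≡ nothing → Grown (g' [ z ≔ e' ])
      grow {g'} {z = z} {e'} G g'y gy f g'z = record
        { extends = λ gw → update-extends g' z e' g'z (extends G gw)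
        ; root    = update-extends g' z e' g'z (root G)
        ; reached = reached-grown
        }
        where
        reached-grown : ∀ {w v} → g w ≡ nothing → (g' [ z ≔ e' ]) w ≡ just v → Path (x , d) (w , v)
        reached-grown {w} gw g''w with update-just g' z e' {w} g''w
        ... | inj₁ (refl , refl) = reached G gy g'y ▷ f
        ... | inj₂ g'w           = reached G gw g'w

      propagate : ∀ g' → Grown g' → Acc _<_ ∣ Unassigned g' ∣ → Outcome x d
      propagate g' G (acc smaller) with defect-or-saturated (extends G)
      ... | inj₂ sat' = inj₁ (g' , sat' , extends G , root G)
      ... | inj₁ (unsupported gy g'y (α , z , H , none)) =
        inj₂ (_ , refute-unsupported (reached G gy g'y) α z H none)
      ... | inj₁ (unclosed {z = z} {e'} g'y f g'z≢e')
        with g' z in g'z | source-is-new (extends G) g'y f g'z≢e'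
      ...   | just e'' | gy = inj₂ (_ , refute-conflict (reached G gy g'y) f (reached G gz g'z) e'≢e'')
        where
        e'≢e'' : e' ≢ e''
        e'≢e'' e'≡e'' = g'z≢e' (trans g'z (cong just (sym e'≡e'')))
        gz = target-is-new (extends G) gy f g'z (e'≢e'' ∘ sym)
      ...   | nothing  | gy =
        propagate (g' [ z ≔ e' ]) (grow G g'y gy f g'z)
                  (smaller (extension-shrinks (update-extends g' z e' g'z) g'z (update-here g' z e')))

      outcome : Outcome x d
      outcome = propagate (g [ x ≔ d ]) start (<-wellFounded _)

  extend-or-obstruct : ∀ g → Saturated g → Acc _<_ ∣ Unassigned g ∣ →
                       Hom A B ⊎ ∃[ P ] (Obstruction B P × Hom P A)
  extend-or-obstruct g sat (acc smaller) with any? (λ x → g x ≟ₘ nothing)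
  ... | no  total = inj₁ (saturated-total⇒hom sat λ y gy → total (y , gy))
  ... | yes (x , x-free) with first-or-all (Propagation.outcome sat x-free)
  ...   | inj₁ (_ , g' , sat' , g⊑g' , g'x) =
    extend-or-obstruct g' sat' (smaller (extension-shrinks g⊑g' x-free g'x))
  ...   | inj₂ refutations = inj₂ (hubPath-obstruction x refutations)

  hom-or-obstruction : Hom A B ⊎ ∃[ P ] (Obstruction B P × Hom P A)
  hom-or-obstruction = extend-or-obstruct empty empty-saturated (<-wellFounded _)

mainTheorem7 : ∀ (m : ℕ) (B : Structure m) → ImplicationalStructure B → PathDuality 2 3 B
mainTheorem7 m B impl =
  Obstruction B , (λ _ → proj₁) , λ A → mk⇔ (no-obstruction A) (hom-if-unobstructed A)
  where
  no-obstruction : ∀ A → Hom A B → ¬ (∃[ P ] (Obstruction B P × Hom P A))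
  no-obstruction A A→B (P , (_ , P↛B) , P→A) = P↛B (hom-trans {P = P} {A} {B} P→A A→B)
  hom-if-unobstructed : ∀ A → ¬ (∃[ P ] (Obstruction B P × Hom P A)) → Hom A B
  hom-if-unobstructed A unobstructed =
    [ id , ⊥-elim ∘ unobstructed ]′ (HomOrObstruction.hom-or-obstruction A B impl)
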